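{- For all integers $m,n\ge 1$, $\chi_{la}(P_{2m}\vee O_{2n})=3$.
   Context: For a connected graph $H=(V,E)$, a local antimagic labeling is a bijection $f:E\to\{1,\dots,|E|\}$ such that $f^+(x)\neq f^+(y)$ for every pair of adjacent vertices $x,y$, where $f^+(x)=\sum_{e\in E(x)}f(e)$ is the sum of labels of edges incident to $x$. The local antimagic chromatic number $\chi_{la}(H)$ is the minimum number of distinct values of $f^+$ over all local antimagic labelings $f$ of $H$. $P_k$ is the path of order $k$, $O_k$ is the null (edgeless) graph of order $k$, and $G\vee H$ is the join of $G$ and $H$ (disjoint union plus all edges between $V(G)$ and $V(H)$). -}

module Defs where

open import Data.Nat using (ℕ; zero; suc; _+_; _*_; _≤_)
open import Data.Nat.Properties using (_≟_)
open import Data.Fin using (Fin; toℕ; _↑ˡ_; _↑ʳ_)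
import Data.Fin as F
open import Data.Fin.Properties using () renaming (_≟_ to _≟ᶠ_)
open import Data.List using (List; []; _∷_; _++_; map; length; lookup; allFin; concatMap; deduplicate)
open import Data.Product using (_×_; _,_; Σ; proj₁; proj₂; ∃)
open import Data.Nat.ListAction using (sum)
open import Data.Bool using (if_then_else_; _∨_)
open import Relation.Nullary using (¬_)
open import Relation.Nullary.Decidable using (⌊_⌋)
open import Function.Definitions using (Bijective)
open import Relation.Binary.PropositionalEquality using (_≡_)

record Graph : Set where
  field
    nV    : ℕ
    edges : List (Fin nV × Fin nV)
open Graph public

nE : Graph → ℕ
nE G = length (edges G)

ends : (G : Graph) → Fin (nE G) → Fin (nV G) × Fin (nV G)
ends G e = lookup (edges G) e

-- Edge labeling: a bijection E → {1,…,|E|}, encoded as a bijection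
-- Fin |E| → Fin |E|, the label of e being 1 + toℕ (f e).
Labeling : Graph → Set
Labeling G = Σ (Fin (nE G) → Fin (nE G)) (λ f → Bijective _≡_ _≡_ f)

label : (G : Graph) → Labeling G → Fin (nE G) → ℕ
label G (f , _) e = suc (toℕ (f e))

incident : (G : Graph) → Fin (nV G) → Fin (nE G) → Data.Bool.Bool
incident G x e = ⌊ proj₁ (ends G e) ≟ᶠ x ⌋ ∨ ⌊ proj₂ (ends G e) ≟ᶠ x ⌋

vsum : (G : Graph) → Labeling G → Fin (nV G) → ℕ
vsum G f x = sum (map (λ e → if incident G x e then label G f e else 0) (allFin (nE G)))

IsLocalAntimagic : (G : Graph) → Labeling G → Set
IsLocalAntimagic G f = ∀ (e : Fin (nE G)) →
  ¬ (vsum G f (proj₁ (ends G e)) ≡ vsum G f (proj₂ (ends G e)))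

numColors : (G : Graph) → Labeling G → ℕ
numColors G f = length (deduplicate _≟_ (map (vsum G f) (allFin (nV G))))

LocalAntimagicChromatic≡ : Graph → ℕ → Set
LocalAntimagicChromatic≡ G c =
  (∃ λ (f : Labeling G) → IsLocalAntimagic G f × numColors G f ≡ c)
  × (∀ (f : Labeling G) → IsLocalAntimagic G f → c ≤ numColors G f)

pathEdges : (k : ℕ) → List (Fin k × Fin k)
pathEdges zero = []
pathEdges (suc zero) = []
pathEdges (suc (suc k)) =
  (F.zero , F.suc F.zero) ∷ map (λ p → F.suc (proj₁ p) , F.suc (proj₂ p)) (pathEdges (suc k))

P : ℕ → Graph
P k = record { nV = k ; edges = pathEdges k }

O : ℕ → Graph
O k = record { nV = k ; edges = [] }

join : Graph → Graph → Graph
join G H = record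
  { nV = nV G + nV H
  ; edges =
      map (λ p → (proj₁ p ↑ˡ nV H) , (proj₂ p ↑ˡ nV H)) (edges G)
      ++ map (λ p → (nV G ↑ʳ proj₁ p) , (nV G ↑ʳ proj₂ p)) (edges H)
      ++ concatMap (λ i → map (λ j → (i ↑ˡ nV H) , (nV G ↑ʳ j)) (allFin (nV H))) (allFin (nV G))
  }

-- Write N = 2m, K = N − 1 and M = 2n. The labels 1, …, K go on the path, alternating between the
-- two ends of that range, so that every even path vertex sees the sum K, every odd interior one
-- N + 1 and the last one 1. The labels K + 1 + a + b·N (a < N, b < M) fill the N × M grid of join
-- edges: in column j the digit a runs through a parity-preserving involution of the rows (the
-- identity for j < n, a reflection τ fixing the last path vertex for j = n, a reflection π of each
-- parity class for j > n), and the digit b is j on even rows and M − 1 − j on odd rows. Then all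
-- columns have the same sum γ, while the row sums make up for the path: even path vertices get α
-- and odd ones β = α + 2n. As γ + (m − 1) + n·c = α + m·c for c = 2(2mn + 2m − 1) > 2n + m − 1,
-- γ differs from β, and from α unless m = n = 1, which is settled by an explicit labeling of
-- P₂ ∨ O₂. Three sums are needed since the first two path vertices and a null vertex form a triangle.
module Submission where

open import Defs
open import Data.Bool using (true; false; if_then_else_; _∨_)
open import Data.Bool.Properties using (∨-identityʳ; if-cong)
open import Data.Fin as Fin using (Fin; toℕ; _↑ˡ_; _↑ʳ_; #_)
open import Data.Fin.Permutation using (transpose)
open import Data.Fin.Properties
  using (any?; all?; toℕ-injective; toℕ-↑ˡ; toℕ-↑ʳ; toℕ<n; toℕ-fromℕ<; injective⇒≤; punchOut-injective)
  renaming (_≟_ to _≟ᶠ_)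
open import Data.List using (List; []; _∷_; _++_; map; length; lookup; tabulate; concat; allFin; filter; deduplicate)
open import Data.List.Membership.Propositional using (_∈_)
open import Data.List.Membership.Propositional.Properties
  using (∈-filter⁺; ∈-deduplicate⁺; ∈-map⁺; ∈-map⁻; ∈-allFin; ∈-++⁺ʳ; ∈-++⁻; ∈-concatMap⁻; ∈-lookup)
open import Data.List.Properties using (length-map; length-tabulate; map-tabulate; tabulate-cong; filter-notAll)
open import Data.List.Relation.Unary.All as All using (All; []; _∷_)
import Data.List.Relation.Unary.All.Properties as Allₚ
open import Data.List.Relation.Unary.AllPairs using ([]; _∷_)
import Data.List.Relation.Unary.Any as Any
open import Data.List.Relation.Unary.Any using (here; there)
open import Data.List.Relation.Unary.Any.Properties using (lookup-index)
open import Data.List.Relation.Unary.Unique.Propositional using (Unique)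
open import Data.List.Relation.Unary.Unique.DecPropositional.Properties using (deduplicate-!)
open import Data.Nat
open import Data.Nat.DivMod
open import Data.Nat.Divisibility using (divides)
open import Data.Nat.ListAction using (sum)
open import Data.Nat.Properties
open import Algebra.Properties.CommutativeSemigroup +-commutativeSemigroup using (interchange; x∙yz≈y∙xz)
open import Data.Nat.Tactic.RingSolver using (solve-∀)
open import Data.Parity.Base using (Parity; 0ℙ; 1ℙ; _⁻¹)
import Data.Parity.Properties as ℙ
open import Data.Product using (Σ; _×_; _,_; proj₁; proj₂)
open import Data.Sum using (_⊎_; inj₁; inj₂)
open import Function using (_∘_; id)
open import Function.Bundles using (Inverse; Bijection)
open import Function.Definitions using (Injective; Surjective)
open import Function.Properties.Inverse using (↔⇒⤖)
open import Relation.Binary using (DecidableEquality; tri<; tri≈; tri>)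
open import Relation.Binary.PropositionalEquality
open import Relation.Nullary using (¬_; yes; no; ¬?; contradiction)
open import Relation.Nullary.Decidable using (⌊_⌋; dec-true; dec-false; toWitness)

private variable A B : Set

-- Sums over ranges

∑< : ℕ → (ℕ → ℕ) → ℕ
∑< zero    f = 0
∑< (suc n) f = f 0 + ∑< n (f ∘ suc)

syntax ∑< n (λ i → e) = ∑[ i < n ] e

∑-cong : ∀ n {f g : ℕ → ℕ} → (∀ i → i < n → f i ≡ g i) → ∑< n f ≡ ∑< n g
∑-cong zero    eq = refl
∑-cong (suc n) eq = cong₂ _+_ (eq 0 z<s) (∑-cong n (λ i i<n → eq (suc i) (s<s i<n)))

∑-distrib-+ : ∀ n (f g : ℕ → ℕ) → ∑[ i < n ] (f i + g i) ≡ ∑< n f + ∑< n g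
∑-distrib-+ zero    f g = refl
∑-distrib-+ (suc n) f g =
  trans (cong (f 0 + g 0 +_) (∑-distrib-+ n (f ∘ suc) (g ∘ suc))) (interchange (f 0) (g 0) _ _)

∑-const : ∀ n c → ∑[ _ < n ] c ≡ n * c
∑-const zero    c = refl
∑-const (suc n) c = cong (c +_) (∑-const n c)

∑-*ʳ : ∀ n (f : ℕ → ℕ) c → ∑[ i < n ] (f i * c) ≡ ∑< n f * c
∑-*ʳ zero    f c = refl
∑-*ʳ (suc n) f c = trans (cong (f 0 * c +_) (∑-*ʳ n (f ∘ suc) c)) (sym (*-distribʳ-+ c (f 0) _))

∑-zero : ∀ n {f : ℕ → ℕ} → (∀ i → i < n → f i ≡ 0) → ∑< n f ≡ 0
∑-zero n eq = trans (∑-cong n eq) (trans (∑-const n 0) (*-zeroʳ n))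

∑-split : ∀ a b (f : ℕ → ℕ) → ∑< (a + b) f ≡ ∑< a f + ∑[ i < b ] f (a + i)
∑-split zero    b f = refl
∑-split (suc a) b f = trans (cong (f 0 +_) (∑-split a b (f ∘ suc))) (sym (+-assoc (f 0) _ _))

∑-snoc : ∀ n (f : ℕ → ℕ) → ∑< (suc n) f ≡ ∑< n f + f n
∑-snoc n f = begin
  ∑< (suc n) f                ≡⟨ cong (λ k → ∑< k f) (+-comm 1 n) ⟩
  ∑< (n + 1) f                ≡⟨ ∑-split n 1 f ⟩
  ∑< n f + (f (n + 0) + 0)    ≡⟨ cong (∑< n f +_) (trans (+-identityʳ _) (cong f (+-identityʳ n))) ⟩
  ∑< n f + f n                ∎
  where open ≡-Reasoning

∑-reverse : ∀ n (f : ℕ → ℕ) → ∑[ i < n ] f (n ∸ suc i) ≡ ∑< n f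
∑-reverse zero    f = refl
∑-reverse (suc n) f = trans (cong (f n +_) (∑-reverse n f)) (trans (+-comm (f n) _) (sym (∑-snoc n f)))

∑-pairs : ∀ p (f : ℕ → ℕ) → ∑< (2 * p) f ≡ ∑[ u < p ] (f (2 * u) + f (suc (2 * u)))
∑-pairs zero    f = refl
∑-pairs (suc p) f = begin
  ∑< (2 * suc p) f
    ≡⟨ cong (λ k → ∑< k f) (*-suc 2 p) ⟩
  f 0 + (f 1 + ∑< (2 * p) (f ∘ suc ∘ suc))
    ≡⟨ sym (+-assoc (f 0) (f 1) _) ⟩
  f 0 + f 1 + ∑< (2 * p) (f ∘ suc ∘ suc)
    ≡⟨ cong (f 0 + f 1 +_) (∑-pairs p (f ∘ suc ∘ suc)) ⟩
  f 0 + f 1 + ∑[ u < p ] (f (2 + 2 * u) + f (3 + 2 * u))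
    ≡⟨ cong (f 0 + f 1 +_) (∑-cong p λ u _ →
         cong₂ (λ a b → f a + f (suc b)) (sym (*-suc 2 u)) (sym (*-suc 2 u))) ⟩
  ∑[ u < suc p ] (f (2 * u) + f (suc (2 * u)))
    ∎
  where open ≡-Reasoning

∑-indicator : ∀ n t (f : ℕ → ℕ) → ∑[ k < n ] (if k ≡ᵇ t then f k else 0) ≡ (if t <ᵇ n then f t else 0)
∑-indicator zero    t       f = refl
∑-indicator (suc n) zero    f = trans (cong (f 0 +_) (∑-zero n λ _ _ → refl)) (+-identityʳ (f 0))
∑-indicator (suc n) (suc t) f = ∑-indicator n t (f ∘ suc)

∑-if : ∀ n b (f : ℕ → ℕ) → ∑[ i < n ] (if b then f i else 0) ≡ (if b then ∑< n f else 0)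
∑-if n true  f = refl
∑-if n false f = ∑-zero n λ _ _ → refl

gauss : ∀ n → ∑[ i < n ] i * 2 + n ≡ n * n
gauss zero    = refl
gauss (suc n) = begin
  ∑[ i < suc n ] i * 2 + suc n      ≡⟨ cong (λ s → s * 2 + suc n) (∑-snoc n (λ i → i)) ⟩
  (∑[ i < n ] i + n) * 2 + suc n    ≡⟨ lemma (∑[ i < n ] i) n ⟩
  (∑[ i < n ] i * 2 + n) + (2 * n + 1) ≡⟨ cong (_+ (2 * n + 1)) (gauss n) ⟩
  n * n + (2 * n + 1)               ≡⟨ square-suc n ⟩
  suc n * suc n                     ∎
  where
  open ≡-Reasoning
  lemma : ∀ s n → (s + n) * 2 + suc n ≡ (s * 2 + n) + (2 * n + 1)
  lemma = solve-∀
  square-suc : ∀ n → n * n + (2 * n + 1) ≡ suc n * suc n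
  square-suc = solve-∀

∑-range : ∀ p → ∑[ i < 2 + 2 * p ] i ≡ suc p * suc (2 * p)
∑-range p = *-cancelʳ-≡ _ _ 2 (+-cancelʳ-≡ (2 + 2 * p) _ _ (trans (gauss (2 + 2 * p)) (square p)))
  where
  square : ∀ p → (2 + 2 * p) * (2 + 2 * p) ≡ suc p * suc (2 * p) * 2 + (2 + 2 * p)
  square = solve-∀

-- Arithmetic and parity

reflect-< : ∀ {L t} → t < L → L ∸ suc t < L
reflect-< {suc L} {t} _ = s≤s (m∸n≤m L t)

reflect-involutive : ∀ {L t} → t < L → L ∸ suc (L ∸ suc t) ≡ t
reflect-involutive {suc L} (s≤s t≤L) = m∸[m∸n]≡n t≤L

[a+bd]%d≡a : ∀ a b d .{{_ : NonZero d}} → a < d → (a + b * d) % d ≡ a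
[a+bd]%d≡a a b d a<d = trans ([m+kn]%n≡m%n a b d) (m<n⇒m%n≡m a<d)

[a+bd]/d≡b : ∀ a b d .{{_ : NonZero d}} → a < d → (a + b * d) / d ≡ b
[a+bd]/d≡b a b d a<d = trans (+-distrib-/-∣ʳ a (divides b refl)) (cong₂ _+_ (m<n⇒m/n≡0 a<d) (m*n/n≡m b d))

r+a*c≡b*c⇒r≡0×a≡b : ∀ {r c} a b → r < c → r + a * c ≡ b * c → r ≡ 0 × a ≡ b
r+a*c≡b*c⇒r≡0×a≡b {r} {c@(suc _)} a b r<c eq =
  r≡0 , *-cancelʳ-≡ a b c (trans (cong (_+ a * c) (sym r≡0)) eq)
  where
  r≡0 : r ≡ 0
  r≡0 = trans (sym ([a+bd]%d≡a r a c r<c)) (trans (cong (_% c) eq) (m*n%n≡0 b c))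

+-≡ᵇ : ∀ a b c → (a + b ≡ᵇ a + c) ≡ (b ≡ᵇ c)
+-≡ᵇ zero    b c = refl
+-≡ᵇ (suc a) b c = +-≡ᵇ a b c

byParity : A → A → Parity → A
byParity e o 0ℙ = e
byParity e o 1ℙ = o

parity-2* : ∀ u → parity (2 * u) ≡ 0ℙ
parity-2* u = ℙ.*-homo-* 2 u

parity-1+2* : ∀ u → parity (suc (2 * u)) ≡ 1ℙ
parity-1+2* u = trans (ℙ.+-homo-+ 1 (2 * u)) (cong _⁻¹ (parity-2* u))

parity-suc : ∀ t → parity (suc t) ≡ parity t ⁻¹
parity-suc t = ℙ.+-homo-+ 1 t

parity-+≡0ℙ : ∀ a b → parity (a + b) ≡ 0ℙ → parity b ≡ parity a
parity-+≡0ℙ a b eq =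
  ℙ.+-cancelˡ-≡ (parity a) _ _ (trans (sym (ℙ.+-homo-+ a b)) (trans eq (sym (ℙ.p+p≡0ℙ (parity a)))))

parity-∸ : ∀ {L t} → parity L ≡ 0ℙ → t ≤ L → parity (L ∸ t) ≡ parity t
parity-∸ {L} {t} even t≤L = parity-+≡0ℙ t (L ∸ t) (trans (cong parity (m+[n∸m]≡n t≤L)) even)

parity-reflect : ∀ {L t} → parity L ≡ 1ℙ → t < L → parity (L ∸ suc t) ≡ parity t
parity-reflect {suc L} odd (s≤s t≤L) = parity-∸ (ℙ.⁻¹-injective (trans (sym (parity-suc L)) odd)) t≤L

-- Sums along lists

indexedSum : List A → (ℕ → A → ℕ) → ℕ
indexedSum []       F = 0
indexedSum (a ∷ as) F = F 0 a + indexedSum as (F ∘ suc)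

indexedSum-cong : ∀ (xs : List A) {F G : ℕ → A → ℕ} → (∀ k a → F k a ≡ G k a) →
                  indexedSum xs F ≡ indexedSum xs G
indexedSum-cong []       eq = refl
indexedSum-cong (x ∷ xs) eq = cong₂ _+_ (eq 0 x) (indexedSum-cong xs (eq ∘ suc))

indexedSum-++ : ∀ (xs ys : List A) F →
                indexedSum (xs ++ ys) F ≡ indexedSum xs F + indexedSum ys (λ k → F (length xs + k))
indexedSum-++ []       ys F = refl
indexedSum-++ (x ∷ xs) ys F =
  trans (cong (F 0 x +_) (indexedSum-++ xs ys (F ∘ suc))) (sym (+-assoc (F 0 x) _ _))

indexedSum-map : ∀ (g : B → A) xs F → indexedSum (map g xs) F ≡ indexedSum xs (λ k → F k ∘ g)
indexedSum-map g []       F = refl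
indexedSum-map g (x ∷ xs) F = cong (F 0 (g x) +_) (indexedSum-map g xs (F ∘ suc))

indexedSum-tabulate : ∀ n (g : Fin n → A) F (G : ℕ → ℕ) → (∀ i → F (toℕ i) (g i) ≡ G (toℕ i)) →
                      indexedSum (tabulate g) F ≡ ∑< n G
indexedSum-tabulate zero    g F G eq = refl
indexedSum-tabulate (suc n) g F G eq =
  cong₂ _+_ (eq Fin.zero) (indexedSum-tabulate n (g ∘ Fin.suc) (F ∘ suc) (G ∘ suc) (eq ∘ Fin.suc))

indexedSum-concat : ∀ (xss : List (List A)) M F → All ((_≡ M) ∘ length) xss →
                    indexedSum (concat xss) F ≡ indexedSum xss (λ i xs → indexedSum xs (λ k → F (k + i * M)))
indexedSum-concat []         M F []                 = refl
indexedSum-concat (xs ∷ xss) M F (refl ∷ lengths) = begin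
  indexedSum (xs ++ concat xss) F
    ≡⟨ indexedSum-++ xs (concat xss) F ⟩
  indexedSum xs F + indexedSum (concat xss) (λ k → F (M + k))
    ≡⟨ cong₂ _+_ (indexedSum-cong xs λ k a → cong (λ z → F z a) (sym (+-identityʳ k)))
                 (indexedSum-concat xss M (λ k → F (M + k)) lengths) ⟩
  indexedSum xs (λ k → F (k + 0)) + indexedSum xss (λ i ys → indexedSum ys (λ k → F (M + (k + i * M))))
    ≡⟨ cong (indexedSum xs (λ k → F (k + 0)) +_) (indexedSum-cong xss λ i ys →
         indexedSum-cong ys λ k a → cong (λ z → F z a) (x∙yz≈y∙xz M k (i * M))) ⟩
  indexedSum (xs ∷ xss) (λ i ys → indexedSum ys (λ k → F (k + i * M)))
    ∎
  where open ≡-Reasoning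

indexedSum-length : ∀ (xs : List A) → indexedSum xs (λ _ _ → 1) ≡ length xs
indexedSum-length []       = refl
indexedSum-length (x ∷ xs) = cong suc (indexedSum-length xs)

sum-tabulate-lookup : ∀ (xs : List A) F → sum (tabulate (λ e → F (toℕ e) (lookup xs e))) ≡ indexedSum xs F
sum-tabulate-lookup []       F = refl
sum-tabulate-lookup (x ∷ xs) F = cong (F 0 x +_) (sum-tabulate-lookup xs (F ∘ suc))

module _ (_≟ᴬ_ : DecidableEquality A) where

  unique⊆⇒length≤ : ∀ {xs ys : List A} → Unique xs → All (_∈ ys) xs → length xs ≤ length ys
  unique⊆⇒length≤ {[]}             _                 _                 = z≤n
  unique⊆⇒length≤ {x ∷ xs} {ys} (x≢xs ∷ unique) (x∈ys ∷ xs⊆ys) = ≤-trans (s≤s ih) ys-x<ys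
    where
    ≢x? = λ z → ¬? (z ≟ᴬ x)
    ih : length xs ≤ length (filter ≢x? ys)
    ih = unique⊆⇒length≤ unique
           (All.tabulate λ z∈xs → ∈-filter⁺ ≢x? (All.lookup xs⊆ys z∈xs) (All.lookup x≢xs z∈xs ∘ sym))
    ys-x<ys : length (filter ≢x? ys) < length ys
    ys-x<ys = filter-notAll ≢x? ys (Any.map (λ { refl x≢x → x≢x refl }) x∈ys)

injective⇒surjective : ∀ {n} (f : Fin n → Fin n) → Injective _≡_ _≡_ f → Surjective _≡_ _≡_ f
injective⇒surjective {zero}  f inj ()
injective⇒surjective {suc n} f inj y with any? (λ x → f x ≟ᶠ y)
... | yes (x , fx≡y) = x , λ { refl → fx≡y }
... | no  y∉im       = contradiction (injective⇒≤ g-injective) 1+n≰n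
  where
  y≢f : ∀ x → y ≢ f x
  y≢f x y≡fx = y∉im (x , sym y≡fx)
  g : Fin (suc n) → Fin n
  g x = Fin.punchOut (y≢f x)
  g-injective : Injective _≡_ _≡_ g
  g-injective eq = inj (punchOut-injective (y≢f _) (y≢f _) eq)

-- Vertex sums and colours

incidentLabel : (ℕ → ℕ) → ℕ → ℕ → ℕ → ℕ → ℕ
incidentLabel ℓ t k a b = if (a ≡ᵇ t) ∨ (b ≡ᵇ t) then ℓ k else 0

⌊≟ᶠ⌋≡toℕ-≡ᵇ : ∀ {n} (a b : Fin n) → ⌊ a ≟ᶠ b ⌋ ≡ (toℕ a ≡ᵇ toℕ b)
⌊≟ᶠ⌋≡toℕ-≡ᵇ a b with a ≟ᶠ b
... | yes refl = sym (dec-true (toℕ a ≟ toℕ a) refl)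
... | no  a≢b  = sym (dec-false (toℕ a ≟ toℕ b) (a≢b ∘ toℕ-injective))

vsum≡indexedSum : ∀ G (f : Labeling G) (ℓ : ℕ → ℕ) → (∀ e → label G f e ≡ ℓ (toℕ e)) → ∀ x →
  vsum G f x ≡ indexedSum (edges G) (λ k p → incidentLabel ℓ (toℕ x) k (toℕ (proj₁ p)) (toℕ (proj₂ p)))
vsum≡indexedSum G f ℓ label≡ x = begin
  sum (map h (allFin (nE G)))         ≡⟨ cong sum (map-tabulate id h) ⟩
  sum (tabulate h)                    ≡⟨ cong sum (tabulate-cong h≡) ⟩
  sum (tabulate (λ e → F (toℕ e) (lookup (edges G) e))) ≡⟨ sum-tabulate-lookup (edges G) F ⟩
  indexedSum (edges G) F              ∎
  where
  open ≡-Reasoning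
  h : Fin (nE G) → ℕ
  h e = if incident G x e then label G f e else 0
  F : ℕ → Fin (nV G) × Fin (nV G) → ℕ
  F k p = incidentLabel ℓ (toℕ x) k (toℕ (proj₁ p)) (toℕ (proj₂ p))
  h≡ : ∀ e → h e ≡ F (toℕ e) (ends G e)
  h≡ e rewrite ⌊≟ᶠ⌋≡toℕ-≡ᵇ (proj₁ (ends G e)) x | ⌊≟ᶠ⌋≡toℕ-≡ᵇ (proj₂ (ends G e)) x | label≡ e
    = refl

labelingFrom : ∀ G (φ ψ : ℕ → ℕ) → (∀ k → k < nE G → φ k < nE G × ψ (φ k) ≡ k) →
  Σ (Labeling G) λ f → ∀ e → label G f e ≡ suc (φ (toℕ e))
labelingFrom G φ ψ inverse = (f , f-injective , injective⇒surjective f f-injective) , cong suc ∘ f-toℕ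
  where
  f : Fin (nE G) → Fin (nE G)
  f e = Fin.fromℕ< (proj₁ (inverse (toℕ e) (toℕ<n e)))
  f-toℕ : ∀ e → toℕ (f e) ≡ φ (toℕ e)
  f-toℕ e = toℕ-fromℕ< _
  f-injective : Injective _≡_ _≡_ f
  f-injective {x} {y} fx≡fy = toℕ-injective (begin
    toℕ x          ≡⟨ sym (proj₂ (inverse (toℕ x) (toℕ<n x))) ⟩
    ψ (φ (toℕ x))  ≡⟨ cong ψ (trans (sym (f-toℕ x)) (trans (cong toℕ fx≡fy) (f-toℕ y))) ⟩
    ψ (φ (toℕ y))  ≡⟨ proj₂ (inverse (toℕ y) (toℕ<n y)) ⟩
    toℕ y          ∎)
    where open ≡-Reasoning

numColors≤ : ∀ G f (cs : List ℕ) → (∀ x → vsum G f x ∈ cs) → numColors G f ≤ length cs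
numColors≤ G f cs sums∈cs = unique⊆⇒length≤ _≟_ (deduplicate-! _≟_ sums)
  (Allₚ.deduplicate⁺ _≟_ (Allₚ.map⁺ (Allₚ.tabulate⁺ sums∈cs)))
  where sums = map (vsum G f) (allFin (nV G))

≤numColors : ∀ G f (xs : List (Fin (nV G))) → Unique (map (vsum G f) xs) → length xs ≤ numColors G f
≤numColors G f xs unique = subst (_≤ numColors G f) (length-map (vsum G f) xs)
  (unique⊆⇒length≤ _≟_ unique (Allₚ.map⁺ (All.universal sum∈colours xs)))
  where
  sum∈colours : ∀ x → vsum G f x ∈ deduplicate _≟_ (map (vsum G f) (allFin (nV G)))
  sum∈colours x = ∈-deduplicate⁺ _≟_ (∈-map⁺ (vsum G f) (∈-allFin x))

adjacent-≢ : ∀ G f → IsLocalAntimagic G f → ∀ {a b} → (a , b) ∈ edges G → vsum G f a ≢ vsum G f b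
adjacent-≢ G f antimagic a∼b eq = antimagic (Any.index a∼b)
  (subst (λ p → vsum G f (proj₁ p) ≡ vsum G f (proj₂ p)) (lookup-index a∼b) eq)

-- The join of a path and a null graph

indexedSum-pathEdges : ∀ K (w : ℕ → ℕ → ℕ → ℕ) →
  indexedSum (pathEdges (suc K)) (λ k p → w k (toℕ (proj₁ p)) (toℕ (proj₂ p))) ≡ ∑[ k < K ] w k k (suc k)
indexedSum-pathEdges zero    w = refl
indexedSum-pathEdges (suc K) w = cong (w 0 0 1 +_)
  (trans (indexedSum-map _ (pathEdges (suc K)) _) (indexedSum-pathEdges K λ k a b → w (suc k) (suc a) (suc b)))

length-pathEdges : ∀ K → length (pathEdges (suc K)) ≡ K
length-pathEdges zero    = refl
length-pathEdges (suc K) = cong suc (trans (length-map _ (pathEdges (suc K))) (length-pathEdges K))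

indexedSum-joinEdges : ∀ K M (w : ℕ → ℕ → ℕ → ℕ) →
  indexedSum (edges (join (P (suc K)) (O M))) (λ k p → w k (toℕ (proj₁ p)) (toℕ (proj₂ p)))
  ≡ ∑[ k < K ] w k k (suc k) + ∑[ i < suc K ] ∑[ j < M ] w (K + (j + i * M)) i (suc K + j)
indexedSum-joinEdges K M w = begin
  indexedSum (pathCopy ++ concat (map row (allFin N))) F
    ≡⟨ indexedSum-++ pathCopy _ F ⟩
  indexedSum pathCopy F + indexedSum (concat (map row (allFin N))) (λ k → F (length pathCopy + k))
    ≡⟨ cong₂ _+_ path≡
         (trans (cong (λ L → indexedSum (concat (map row (allFin N))) (λ k → F (L + k))) length-pathCopy) join≡) ⟩
  ∑[ k < K ] w k k (suc k) + ∑[ i < N ] ∑[ j < M ] w (K + (j + i * M)) i (N + j)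
    ∎
  where
  open ≡-Reasoning
  N = suc K
  F : ℕ → Fin (N + M) × Fin (N + M) → ℕ
  F k p = w k (toℕ (proj₁ p)) (toℕ (proj₂ p))
  pathCopy = map (λ p → (proj₁ p ↑ˡ M) , (proj₂ p ↑ˡ M)) (pathEdges N)
  row : Fin N → List (Fin (N + M) × Fin (N + M))
  row i = map (λ j → (i ↑ˡ M) , (N ↑ʳ j)) (allFin M)
  length-pathCopy : length pathCopy ≡ K
  length-pathCopy = trans (length-map _ (pathEdges N)) (length-pathEdges K)
  path≡ : indexedSum pathCopy F ≡ ∑[ k < K ] w k k (suc k)
  path≡ = trans (indexedSum-map _ (pathEdges N) F)
    (trans (indexedSum-cong (pathEdges N) λ k p →
              cong₂ (w k) (toℕ-↑ˡ (proj₁ p) M) (toℕ-↑ˡ (proj₂ p) M))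
           (indexedSum-pathEdges K w))
  row≡ : ∀ i → indexedSum (row i) (λ k → F (K + (k + toℕ i * M)))
             ≡ ∑[ j < M ] w (K + (j + toℕ i * M)) (toℕ i) (N + j)
  row≡ i = trans (indexedSum-map _ (allFin M) _) (indexedSum-tabulate M id _ _ λ j →
    cong₂ (w _) (toℕ-↑ˡ i M) (toℕ-↑ʳ N j))
  join≡ : indexedSum (concat (map row (allFin N))) (λ k → F (K + k))
          ≡ ∑[ i < N ] ∑[ j < M ] w (K + (j + i * M)) i (N + j)
  join≡ = begin
    indexedSum (concat (map row (allFin N))) (λ k → F (K + k))
      ≡⟨ indexedSum-concat (map row (allFin N)) M (λ k → F (K + k))
           (Allₚ.map⁺ {f = row} (Allₚ.tabulate⁺ {f = id} λ i →
              trans (length-map _ (allFin M)) (length-tabulate id))) ⟩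
    indexedSum (map row (allFin N)) (λ i xs → indexedSum xs (λ k → F (K + (k + i * M))))
      ≡⟨ indexedSum-map row (allFin N) (λ i xs → indexedSum xs (λ k → F (K + (k + i * M)))) ⟩
    indexedSum (allFin N) (λ i r → indexedSum (row r) (λ k → F (K + (k + i * M))))
      ≡⟨ indexedSum-tabulate N id (λ i r → indexedSum (row r) (λ k → F (K + (k + i * M))))
                                  (λ i → ∑[ j < M ] w (K + (j + i * M)) i (N + j)) row≡ ⟩
    ∑[ i < N ] ∑[ j < M ] w (K + (j + i * M)) i (N + j)
      ∎

nE-join : ∀ K M → nE (join (P (suc K)) (O M)) ≡ K + suc K * M
nE-join K M = begin
  length (edges (join (P (suc K)) (O M)))
    ≡⟨ sym (indexedSum-length (edges (join (P (suc K)) (O M)))) ⟩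
  indexedSum (edges (join (P (suc K)) (O M))) (λ _ _ → 1)
    ≡⟨ indexedSum-joinEdges K M (λ _ _ _ → 1) ⟩
  ∑[ k < K ] 1 + ∑[ i < suc K ] ∑[ j < M ] 1
    ≡⟨ cong₂ _+_ (count K) (trans (∑-cong (suc K) λ _ _ → count M) (∑-const (suc K) M)) ⟩
  K + suc K * M
    ∎
  where
  open ≡-Reasoning
  count : ∀ n → ∑[ _ < n ] 1 ≡ n
  count n = trans (∑-const n 1) (*-identityʳ n)

module JoinVertexSums (K M : ℕ) (ℓ : ℕ → ℕ) where

  private
    N : ℕ
    N = suc K

  pathPart : ℕ → ℕ
  pathPart t = ∑[ k < K ] incidentLabel ℓ t k k (suc k)

  joinPart : ℕ → ℕ
  joinPart t = ∑[ i < N ] ∑[ j < M ] incidentLabel ℓ t (K + (j + i * M)) i (N + j)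

  vsum-join : (f : Labeling (join (P N) (O M))) → (∀ e → label (join (P N) (O M)) f e ≡ ℓ (toℕ e)) →
              ∀ x → vsum (join (P N) (O M)) f x ≡ pathPart (toℕ x) + joinPart (toℕ x)
  vsum-join f label≡ x =
    trans (vsum≡indexedSum (join (P N) (O M)) f ℓ label≡ x) (indexedSum-joinEdges K M (incidentLabel ℓ (toℕ x)))

  edgeBefore : ℕ → ℕ
  edgeBefore zero    = 0
  edgeBefore (suc t) = if t <ᵇ K then ℓ t else 0

  pathPart≡ : ∀ t → pathPart t ≡ (if t <ᵇ K then ℓ t else 0) + edgeBefore t
  pathPart≡ t = begin
    pathPart t
      ≡⟨ ∑-cong K (λ k _ → split k t) ⟩
    ∑[ k < K ] ((if k ≡ᵇ t then ℓ k else 0) + (if suc k ≡ᵇ t then ℓ k else 0))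
      ≡⟨ ∑-distrib-+ K (λ k → if k ≡ᵇ t then ℓ k else 0) (λ k → if suc k ≡ᵇ t then ℓ k else 0) ⟩
    ∑[ k < K ] (if k ≡ᵇ t then ℓ k else 0) + ∑[ k < K ] (if suc k ≡ᵇ t then ℓ k else 0)
      ≡⟨ cong₂ _+_ (∑-indicator K t ℓ) (before t) ⟩
    (if t <ᵇ K then ℓ t else 0) + edgeBefore t
      ∎
    where
    open ≡-Reasoning
    split : ∀ k t {v} → (if (k ≡ᵇ t) ∨ (suc k ≡ᵇ t) then v else 0)
                        ≡ (if k ≡ᵇ t then v else 0) + (if suc k ≡ᵇ t then v else 0)
    split zero    zero          = sym (+-identityʳ _)
    split zero    (suc zero)    = refl
    split zero    (suc (suc t)) = refl
    split (suc k) zero          = refl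
    split (suc k) (suc t)       = split k t
    before : ∀ t → ∑[ k < K ] (if suc k ≡ᵇ t then ℓ k else 0) ≡ edgeBefore t
    before zero    = ∑-zero K λ _ _ → refl
    before (suc t) = ∑-indicator K t ℓ

  joinPart-path : ∀ {t} → t < N → joinPart t ≡ ∑[ j < M ] ℓ (K + (j + t * M))
  joinPart-path {t} t<N = begin
    joinPart t
      ≡⟨ ∑-cong N (λ i _ → ∑-cong M λ j _ → cong (λ b → if b then ℓ (K + (j + i * M)) else 0)
           (trans (cong ((i ≡ᵇ t) ∨_) (dec-false (N + j ≟ t) (>⇒≢ (≤-trans t<N (m≤m+n N j)))))
                  (∨-identityʳ _))) ⟩
    ∑[ i < N ] ∑[ j < M ] (if i ≡ᵇ t then ℓ (K + (j + i * M)) else 0)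
      ≡⟨ ∑-cong N (λ i _ → ∑-if M (i ≡ᵇ t) (λ j → ℓ (K + (j + i * M)))) ⟩
    ∑[ i < N ] (if i ≡ᵇ t then ∑[ j < M ] ℓ (K + (j + i * M)) else 0)
      ≡⟨ ∑-indicator N t (λ i → ∑[ j < M ] ℓ (K + (j + i * M))) ⟩
    (if t <ᵇ N then ∑[ j < M ] ℓ (K + (j + t * M)) else 0)
      ≡⟨ cong (λ b → if b then ∑[ j < M ] ℓ (K + (j + t * M)) else 0) (dec-true (t <? N) t<N) ⟩
    ∑[ j < M ] ℓ (K + (j + t * M))
      ∎
    where open ≡-Reasoning

  joinPart-null : ∀ {j₀} → j₀ < M → joinPart (N + j₀) ≡ ∑[ i < N ] ℓ (K + (j₀ + i * M))
  joinPart-null {j₀} j₀<M = begin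
    joinPart (N + j₀)
      ≡⟨ ∑-cong N (λ i i<N → ∑-cong M λ j _ → cong (λ b → if b then ℓ (K + (j + i * M)) else 0)
           (cong₂ _∨_ (dec-false (i ≟ N + j₀) (<⇒≢ (≤-trans i<N (m≤m+n N j₀)))) (+-≡ᵇ N j j₀))) ⟩
    ∑[ i < N ] ∑[ j < M ] (if j ≡ᵇ j₀ then ℓ (K + (j + i * M)) else 0)
      ≡⟨ ∑-cong N (λ i _ → ∑-indicator M j₀ (λ j → ℓ (K + (j + i * M)))) ⟩
    ∑[ i < N ] (if j₀ <ᵇ M then ℓ (K + (j₀ + i * M)) else 0)
      ≡⟨ ∑-cong N (λ i _ → cong (λ b → if b then ℓ (K + (j₀ + i * M)) else 0) (dec-true (j₀ <? M) j₀<M)) ⟩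
    ∑[ i < N ] ℓ (K + (j₀ + i * M))
      ∎
    where open ≡-Reasoning

pathEdges-consecutive : ∀ K {p} → p ∈ pathEdges (suc K) → toℕ (proj₂ p) ≡ suc (toℕ (proj₁ p))
pathEdges-consecutive (suc K) (here refl) = refl
pathEdges-consecutive (suc K) (there p∈) with ∈-map⁻ _ p∈
... | q , q∈ , refl = cong suc (pathEdges-consecutive K q∈)

joinEdge-cases : ∀ K M {p} → p ∈ edges (join (P (suc K)) (O M)) →
    (toℕ (proj₂ p) ≡ suc (toℕ (proj₁ p)) × toℕ (proj₂ p) < suc K)
  ⊎ (toℕ (proj₁ p) < suc K × suc K ≤ toℕ (proj₂ p))
joinEdge-cases K M p∈ with ∈-++⁻ (map _ (pathEdges (suc K))) p∈
... | inj₁ p∈path with ∈-map⁻ _ p∈path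
...   | (a , b) , ab∈ , refl rewrite toℕ-↑ˡ a M | toℕ-↑ˡ b M =
  inj₁ (pathEdges-consecutive K ab∈ , toℕ<n b)
joinEdge-cases K M p∈ | inj₂ p∈join with Any.satisfied (∈-concatMap⁻ _ {xs = allFin (suc K)} p∈join)
... | i , p∈row with ∈-map⁻ _ p∈row
...   | j , _ , refl rewrite toℕ-↑ˡ i M | toℕ-↑ʳ (suc K) j = inj₂ (toℕ<n i , m≤m+n (suc K) (toℕ j))

localAntimagic-join : ∀ K M (f : Labeling (join (P (suc K)) (O M))) (c : ℕ → ℕ) →
  (∀ x → vsum (join (P (suc K)) (O M)) f x ≡ c (toℕ x)) →
  (∀ t → suc t < suc K → c t ≢ c (suc t)) → (∀ {t u} → t < suc K → suc K ≤ u → c t ≢ c u) →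
  IsLocalAntimagic (join (P (suc K)) (O M)) f
localAntimagic-join K M f c vsum≡c path≢ join≢ e eq
  with joinEdge-cases K M (∈-lookup {xs = edges (join (P (suc K)) (O M))} e)
... | inj₁ (t₂≡ , t₂<N) = path≢ _ (subst (_< suc K) t₂≡ t₂<N)
  (trans (sym (vsum≡c _)) (trans eq (trans (vsum≡c _) (cong c t₂≡))))
... | inj₂ (t<N , N≤u) = join≢ t<N N≤u (trans (sym (vsum≡c _)) (trans eq (vsum≡c _)))

3≤numColors : ∀ K M (f : Labeling (join (P (2 + K)) (O (suc M)))) →
  IsLocalAntimagic (join (P (2 + K)) (O (suc M))) f → 3 ≤ numColors (join (P (2 + K)) (O (suc M))) f
3≤numColors K M f antimagic = ≤numColors G f (v₀ ∷ v₁ ∷ u₀ ∷ [])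
  ((≢ v₀∼v₁ ∷ ≢ v₀∼u₀ ∷ []) ∷ (≢ v₁∼u₀ ∷ []) ∷ [] ∷ [])
  where
  N = 2 + K
  G = join (P N) (O (suc M))
  ≢ = adjacent-≢ G f antimagic
  v₀ v₁ u₀ : Fin (N + suc M)
  v₀ = Fin.zero {suc K} ↑ˡ suc M
  v₁ = Fin.suc (Fin.zero {K}) ↑ˡ suc M
  u₀ = N ↑ʳ Fin.zero
  pathCopy = map (λ p → (proj₁ p ↑ˡ suc M) , (proj₂ p ↑ˡ suc M)) (pathEdges N)
  row : Fin N → List (Fin (N + suc M) × Fin (N + suc M))
  row i = map (λ j → (i ↑ˡ suc M) , (N ↑ʳ j)) (allFin (suc M))
  v₀∼v₁ : (v₀ , v₁) ∈ edges G
  v₀∼v₁ = here refl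
  v₀∼u₀ : (v₀ , u₀) ∈ edges G
  v₀∼u₀ = ∈-++⁺ʳ pathCopy (here refl)
  v₁∼u₀ : (v₁ , u₀) ∈ edges G
  v₁∼u₀ = ∈-++⁺ʳ pathCopy (∈-++⁺ʳ (row Fin.zero) (here refl))

module P₂ₘ∨O₂ₙ (m' n' : ℕ) where

  m n K N M : ℕ
  m = suc m'
  n = suc n'
  K = suc (2 * m')
  N = suc K
  M = 2 * n

  parity-K : parity K ≡ 1ℙ
  parity-K = parity-1+2* m'

  -- φ k is the label of edge k minus one, edges being indexed as in indexedSum-joinEdges: the path
  -- edges take 0, …, K − 1 and the join edge between path vertex i and null vertex j takes
  -- K + lowDigit i j + highDigit i j · N.

  pathLabel : ℕ → ℕ
  pathLabel k = byParity (K ∸ suc k) k (parity k)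

  τ : ℕ → ℕ
  τ i = if i ≡ᵇ K then K else K ∸ suc i

  π : ℕ → ℕ
  π i = byParity (K ∸ suc i) (N ∸ i) (parity i)

  lowDigit : ℕ → ℕ → ℕ
  lowDigit i j = if j <ᵇ n then i else if j ≡ᵇ n then τ i else π i

  highDigit : ℕ → ℕ → ℕ
  highDigit i j = byParity j (M ∸ suc j) (parity i)

  joinLabel : ℕ → ℕ
  joinLabel x = lowDigit (x / M) (x % M) + highDigit (x / M) (x % M) * N

  joinIndex : ℕ → ℕ
  joinIndex y = highDigit (y % N) (y / N) + lowDigit (y % N) (highDigit (y % N) (y / N)) * M

  φ : ℕ → ℕ
  φ k = if k <ᵇ K then pathLabel k else K + joinLabel (k ∸ K)

  ψ : ℕ → ℕ
  ψ l = if l <ᵇ K then pathLabel l else K + joinIndex (l ∸ K)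

  τ-K : τ K ≡ K
  τ-K = if-cong (dec-true (K ≟ K) refl)

  τ-< : ∀ {i} → i < K → τ i ≡ K ∸ suc i
  τ-< {i} i<K = if-cong (dec-false (i ≟ K) (<⇒≢ i<K))

  lowDigit-< : ∀ i {j} → j < n → lowDigit i j ≡ i
  lowDigit-< i {j} j<n = if-cong (dec-true (j <? n) j<n)

  lowDigit-n : ∀ i → lowDigit i n ≡ τ i
  lowDigit-n i = trans (if-cong (dec-false (n <? n) (n≮n n))) (if-cong (dec-true (n ≟ n) refl))

  lowDigit-> : ∀ i {j} → n < j → lowDigit i j ≡ π i
  lowDigit-> i {j} n<j = trans (if-cong (dec-false (j <? n) (<⇒≯ n<j))) (if-cong (dec-false (j ≟ n) (>⇒≢ n<j)))

  pathLabel-involution : ∀ {k} → k < K → pathLabel k < K × pathLabel (pathLabel k) ≡ k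
  pathLabel-involution {k} k<K with parity k in pk
  ... | 0ℙ rewrite parity-reflect parity-K k<K | pk = reflect-< k<K , reflect-involutive k<K
  ... | 1ℙ rewrite pk = k<K , refl

  ParityInvolution : (ℕ → ℕ) → Set
  ParityInvolution σ = ∀ {i} → i < N → σ i < N × σ (σ i) ≡ i × parity (σ i) ≡ parity i

  even<N⇒<K : ∀ {i} → i < N → parity i ≡ 0ℙ → i < K
  even<N⇒<K {i} i<N even = ≤∧≢⇒< (≤-pred i<N) λ { refl → ℙ.p≢p⁻¹ 0ℙ (trans (sym even) parity-K) }

  τ-involution : ParityInvolution τ
  τ-involution {i} i<N with i ≟ K
  ... | yes refl = subst (_< N) (sym τ-K) ≤-refl , trans (cong τ τ-K) τ-K , cong parity τ-K
  ... | no  i≢K  with ≤∧≢⇒< (≤-pred i<N) i≢K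
  ...   | i<K rewrite τ-< i<K | τ-< (reflect-< i<K) =
    m<n⇒m<1+n (reflect-< i<K) , reflect-involutive i<K , parity-reflect parity-K i<K

  π-involution : ParityInvolution π
  π-involution {i} i<N with parity i in pi
  ... | 0ℙ with even<N⇒<K i<N pi
  ...   | i<K rewrite parity-reflect parity-K i<K | pi =
    m<n⇒m<1+n (reflect-< i<K) , reflect-involutive i<K , refl
  π-involution {i} i<N | 1ℙ rewrite parity-∸ (parity-2* m') (<⇒≤ i<N) | pi =
    N∸odd<N i<N pi , m∸[m∸n]≡n (<⇒≤ i<N) , refl
    where
    N∸odd<N : ∀ {i} → i < N → parity i ≡ 1ℙ → N ∸ i < N
    N∸odd<N {suc i} 1+i<N _ = reflect-< {N} (<-trans (n<1+n i) 1+i<N)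

  lowDigit-involution : ∀ j → ParityInvolution (λ i → lowDigit i j)
  lowDigit-involution j i<N with j <ᵇ n
  ... | true  = i<N , refl , refl
  ... | false with j ≡ᵇ n
  ...   | true  = τ-involution i<N
  ...   | false = π-involution i<N

  highDigit-involution : ∀ i {j} → j < M → highDigit i j < M × highDigit i (highDigit i j) ≡ j
  highDigit-involution i j<M with parity i
  ... | 0ℙ = j<M , refl
  ... | 1ℙ = reflect-< j<M , reflect-involutive j<M

  joinLabel-decode : ∀ i {j} → j < M → joinLabel (j + i * M) ≡ lowDigit i j + highDigit i j * N
  joinLabel-decode i {j} j<M rewrite [a+bd]%d≡a j i M j<M | [a+bd]/d≡b j i M j<M = refl

  joinIndex-decode : ∀ {a} b → a < N → joinIndex (a + b * N) ≡ highDigit a b + lowDigit a (highDigit a b) * M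
  joinIndex-decode {a} b a<N rewrite [a+bd]%d≡a a b N a<N | [a+bd]/d≡b a b N a<N = refl

  joinLabel-inverse : ∀ {i j} → i < N → j < M →
    joinLabel (j + i * M) < N * M × joinIndex (joinLabel (j + i * M)) ≡ j + i * M
  joinLabel-inverse {i} {j} i<N j<M rewrite joinLabel-decode i j<M = bound , inverse
    where
    a = lowDigit i j
    b = highDigit i j
    a<N = proj₁ (lowDigit-involution j i<N)
    a-involutive = proj₁ (proj₂ (lowDigit-involution j i<N))
    parity-a = proj₂ (proj₂ (lowDigit-involution j i<N))
    b<M = proj₁ (highDigit-involution i j<M)
    b-involutive = proj₂ (highDigit-involution i j<M)
    bound : a + b * N < N * M
    bound = begin-strict
      a + b * N  <⟨ +-monoˡ-< (b * N) a<N ⟩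
      suc b * N  ≤⟨ *-monoˡ-≤ N b<M ⟩
      M * N      ≡⟨ *-comm M N ⟩
      N * M      ∎
      where open ≤-Reasoning
    highDigit-a : highDigit a b ≡ j
    highDigit-a = trans (cong (byParity b (M ∸ suc b)) parity-a) b-involutive
    inverse : joinIndex (a + b * N) ≡ j + i * M
    inverse = trans (joinIndex-decode b a<N)
      (cong₂ (λ j′ i′ → j′ + i′ * M) highDigit-a (trans (cong (lowDigit a) highDigit-a) a-involutive))

  φ-path : ∀ {k} → k < K → φ k ≡ pathLabel k
  φ-path {k} k<K = if-cong (dec-true (k <? K) k<K)

  ψ-path : ∀ {l} → l < K → ψ l ≡ pathLabel l
  ψ-path {l} l<K = if-cong (dec-true (l <? K) l<K)

  φ-join : ∀ x → φ (K + x) ≡ K + joinLabel x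
  φ-join x = trans (if-cong (dec-false (K + x <? K) (m+n≮m K x))) (cong (λ y → K + joinLabel y) (m+n∸m≡n K x))

  ψ-join : ∀ y → ψ (K + y) ≡ K + joinIndex y
  ψ-join y = trans (if-cong (dec-false (K + y <? K) (m+n≮m K y))) (cong (λ z → K + joinIndex z) (m+n∸m≡n K y))

  φ-inverse-join : ∀ {i j} → i < N → j < M →
    φ (K + (j + i * M)) < K + N * M × ψ (φ (K + (j + i * M))) ≡ K + (j + i * M)
  φ-inverse-join {i} {j} i<N j<M rewrite φ-join (j + i * M) | ψ-join (joinLabel (j + i * M)) =
    +-monoʳ-< K (proj₁ (joinLabel-inverse i<N j<M)) , cong (K +_) (proj₂ (joinLabel-inverse i<N j<M))

  φ-inverse : ∀ k → k < K + N * M → φ k < K + N * M × ψ (φ k) ≡ k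
  φ-inverse k k<q with k <? K
  ... | yes k<K with pathLabel-involution k<K
  ...   | pk<K , pk-involutive rewrite φ-path k<K | ψ-path pk<K = m≤n⇒m≤n+o (N * M) pk<K , pk-involutive
  φ-inverse k k<q | no k≮K = subst (λ k → φ k < K + N * M × ψ (φ k) ≡ k) k≡
                        (φ-inverse-join (m<n*o⇒m/o<n x<NM) (m%n<n x M))
    where
    x = k ∸ K
    k≡ : K + (x % M + x / M * M) ≡ k
    k≡ = trans (cong (K +_) (sym (m≡m%n+[m/n]*n x M))) (m+[n∸m]≡n (≮⇒≥ k≮K))
    x<NM : x < N * M
    x<NM = +-cancelˡ-< K x (N * M) (subst (_< K + N * M) (sym (m+[n∸m]≡n (≮⇒≥ k≮K))) k<q)

  G : Graph
  G = join (P N) (O M)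

  φ-labeling : Σ (Labeling G) λ f → ∀ e → label G f e ≡ suc (φ (toℕ e))
  φ-labeling = labelingFrom G φ ψ λ k k<E →
    subst (λ E → φ k < E × ψ (φ k) ≡ k) (sym (nE-join K M)) (φ-inverse k (subst (k <_) (nE-join K M) k<E))

  open JoinVertexSums K M (suc ∘ φ)

  label-joinEdge : ∀ i {j} → j < M → suc (φ (K + (j + i * M))) ≡ N + (lowDigit i j + highDigit i j * N)
  label-joinEdge i j<M = cong suc (trans (φ-join _) (cong (K +_) (joinLabel-decode i j<M)))

  ∑-N+digits : ∀ R (a b : ℕ → ℕ) → ∑[ j < R ] (N + (a j + b j * N)) ≡ R * N + (∑< R a + ∑< R b * N)
  ∑-N+digits R a b = begin
    ∑[ j < R ] (N + (a j + b j * N))          ≡⟨ ∑-distrib-+ R (λ _ → N) (λ j → a j + b j * N) ⟩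
    ∑[ _ < R ] N + ∑[ j < R ] (a j + b j * N) ≡⟨ cong₂ _+_ (∑-const R N) (∑-distrib-+ R a (λ j → b j * N)) ⟩
    R * N + (∑< R a + ∑[ j < R ] (b j * N))   ≡⟨ cong (λ x → R * N + (∑< R a + x)) (∑-*ʳ R b N) ⟩
    R * N + (∑< R a + ∑< R b * N)             ∎
    where open ≡-Reasoning

  joinPart-row : ∀ {t} → t < N →
    joinPart t ≡ M * N + (∑[ j < M ] lowDigit t j + ∑[ j < M ] highDigit t j * N)
  joinPart-row {t} t<N = trans (joinPart-path t<N)
    (trans (∑-cong M λ j j<M → label-joinEdge t j<M) (∑-N+digits M (lowDigit t) (highDigit t)))

  joinPart-column : ∀ {j} → j < M →
    joinPart (N + j) ≡ N * N + (∑[ i < N ] lowDigit i j + ∑[ i < N ] highDigit i j * N)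
  joinPart-column {j} j<M = trans (joinPart-null j<M)
    (trans (∑-cong N λ i _ → label-joinEdge i j<M) (∑-N+digits N (λ i → lowDigit i j) (λ i → highDigit i j)))

  highDigit-row : ∀ t → ∑[ j < M ] highDigit t j ≡ ∑[ j < M ] j
  highDigit-row t with parity t
  ... | 0ℙ = refl
  ... | 1ℙ = ∑-reverse M id

  lowDigit-row : ∀ t → ∑[ j < M ] lowDigit t j ≡ n * t + (τ t + n' * π t)
  lowDigit-row t = begin
    ∑< (n + (n + 0)) (lowDigit t)
      ≡⟨ ∑-split n (n + 0) (lowDigit t) ⟩
    ∑< n (lowDigit t) + (lowDigit t (n + 0) + ∑[ j < n' + 0 ] lowDigit t (n + suc j))
      ≡⟨ cong₂ _+_ (trans (∑-cong n (λ j j<n → lowDigit-< t j<n)) (∑-const n t))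
                   (cong₂ _+_ (trans (cong (lowDigit t) (+-identityʳ n)) (lowDigit-n t))
                              (trans (∑-cong (n' + 0) λ j _ → lowDigit-> t (m<m+n n z<s))
                                     (trans (∑-const (n' + 0) (π t)) (cong (_* π t) (+-identityʳ n'))))) ⟩
    n * t + (τ t + n' * π t)
      ∎
    where open ≡-Reasoning

  τ-sum : ∑[ i < N ] τ i ≡ ∑[ i < N ] i
  τ-sum = begin
    ∑< (suc K) τ                ≡⟨ ∑-snoc K τ ⟩
    ∑< K τ + τ K                ≡⟨ cong₂ _+_ (∑-cong K λ i i<K → τ-< i<K) τ-K ⟩
    ∑[ i < K ] (K ∸ suc i) + K  ≡⟨ cong (_+ K) (∑-reverse K id) ⟩
    ∑[ i < K ] i + K            ≡⟨ sym (∑-snoc K id) ⟩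
    ∑[ i < N ] i                ∎
    where open ≡-Reasoning

  π-pair : ∀ {u} → u < m → π (2 * u) + π (suc (2 * u)) ≡ 2 * (m ∸ suc u) + suc (2 * (m ∸ suc u))
  π-pair {u} (s≤s u≤m') = cong₂ _+_
    (trans (cong (byParity (K ∸ suc (2 * u)) _) (parity-2* u)) (sym (*-distribˡ-∸ 2 m' u)))
    (trans (cong (byParity _ (N ∸ suc (2 * u))) (parity-1+2* u))
           (trans (+-∸-assoc 1 (*-monoʳ-≤ 2 u≤m')) (cong suc (sym (*-distribˡ-∸ 2 m' u)))))

  π-sum : ∑[ i < N ] π i ≡ ∑[ i < N ] i
  π-sum = begin
    ∑< N π                                            ≡⟨ cong (λ L → ∑< L π) (sym (*-suc 2 m')) ⟩
    ∑< (2 * m) π                                      ≡⟨ ∑-pairs m π ⟩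
    ∑[ u < m ] (π (2 * u) + π (suc (2 * u)))          ≡⟨ ∑-cong m (λ u u<m → π-pair u<m) ⟩
    ∑[ u < m ] pair (m ∸ suc u)                       ≡⟨ ∑-reverse m pair ⟩
    ∑< m pair                                         ≡⟨ sym (∑-pairs m id) ⟩
    ∑[ i < 2 * m ] i                                  ≡⟨ cong (λ L → ∑< L id) (*-suc 2 m') ⟩
    ∑[ i < N ] i                                      ∎
    where
    open ≡-Reasoning
    pair : ℕ → ℕ
    pair v = 2 * v + suc (2 * v)

  lowDigit-column : ∀ j → ∑[ i < N ] lowDigit i j ≡ ∑[ i < N ] i
  lowDigit-column j with <-cmp j n
  ... | tri< j<n _ _ = ∑-cong N λ i _ → lowDigit-< i j<n
  ... | tri≈ _ refl _ = trans (∑-cong N λ i _ → lowDigit-n i) τ-sum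
  ... | tri> _ _ n<j = trans (∑-cong N λ i _ → lowDigit-> i n<j) π-sum

  highDigit-column : ∀ {j} → j < M → ∑[ i < N ] highDigit i j ≡ m * pred M
  highDigit-column {j} j<M = begin
    ∑[ i < N ] highDigit i j
      ≡⟨ cong (λ L → ∑[ i < L ] highDigit i j) (sym (*-suc 2 m')) ⟩
    ∑[ i < 2 * m ] highDigit i j
      ≡⟨ ∑-pairs m (λ i → highDigit i j) ⟩
    ∑[ u < m ] (highDigit (2 * u) j + highDigit (suc (2 * u)) j)
      ≡⟨ ∑-cong m (λ u _ → cong₂ _+_ (cong (byParity j (M ∸ suc j)) (parity-2* u))
                                       (cong (byParity j (M ∸ suc j)) (parity-1+2* u))) ⟩
    ∑[ u < m ] (j + (M ∸ suc j))
      ≡⟨ ∑-cong m (λ _ _ → m+[n∸m]≡n (≤-pred j<M)) ⟩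
    ∑[ u < m ] pred M
      ≡⟨ ∑-const m (pred M) ⟩
    m * pred M
      ∎
    where open ≡-Reasoning

  label-pathEdge-even : ∀ {k} → k < K → parity k ≡ 0ℙ → suc (φ k) ≡ K ∸ k
  label-pathEdge-even {k} k<K even = trans (cong suc (trans (φ-path k<K) (cong (byParity (K ∸ suc k) k) even)))
                              (sym (+-∸-assoc 1 (≤-pred k<K)))

  label-pathEdge-odd : ∀ {k} → k < K → parity k ≡ 1ℙ → suc (φ k) ≡ suc k
  label-pathEdge-odd {k} k<K odd = cong suc (trans (φ-path k<K) (cong (byParity (K ∸ suc k) k) odd))

  pathPart-even : ∀ {t} → t < N → parity t ≡ 0ℙ → pathPart t ≡ K
  pathPart-even {t} t<N even = begin
    pathPart t                                        ≡⟨ pathPart≡ t ⟩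
    (if t <ᵇ K then suc (φ t) else 0) + edgeBefore t  ≡⟨ cong₂ _+_ (trans (if-cong (dec-true (t <? K) t<K))
                                                                          (label-pathEdge-even t<K even))
                                                                   (before t even t<K) ⟩
    K ∸ t + t                                         ≡⟨ m∸n+n≡m (<⇒≤ t<K) ⟩
    K                                                 ∎
    where
    open ≡-Reasoning
    t<K = even<N⇒<K t<N even
    before : ∀ t → parity t ≡ 0ℙ → t < K → edgeBefore t ≡ t
    before zero    _    _   = refl
    before (suc t) even 1+t<K = trans (if-cong (dec-true (t <? K) t<K′))
                                      (label-pathEdge-odd t<K′ (ℙ.⁻¹-injective (trans (sym (parity-suc t)) even)))
      where t<K′ = <-trans (n<1+n t) 1+t<K

  pathPart-odd : ∀ {t} → t < K → parity t ≡ 1ℙ → pathPart t ≡ suc N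
  pathPart-odd {suc t} t<K odd = begin
    pathPart (suc t)
      ≡⟨ pathPart≡ (suc t) ⟩
    (if suc t <ᵇ K then suc (φ (suc t)) else 0) + (if t <ᵇ K then suc (φ t) else 0)
      ≡⟨ cong₂ _+_ (trans (if-cong (dec-true (suc t <? K) t<K)) (label-pathEdge-odd t<K odd))
                   (trans (if-cong (dec-true (t <? K) t'<K))
                          (label-pathEdge-even t'<K (ℙ.⁻¹-injective (trans (sym (parity-suc t)) odd)))) ⟩
    suc (suc t) + (K ∸ t)
      ≡⟨ cong (suc ∘ suc) (m+[n∸m]≡n (<⇒≤ t'<K)) ⟩
    suc N
      ∎
    where
    open ≡-Reasoning
    t'<K = <-trans (n<1+n t) t<K

  pathPart-K : pathPart K ≡ 1
  pathPart-K = begin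
    pathPart K                                                          ≡⟨ pathPart≡ K ⟩
    (if K <ᵇ K then suc (φ K) else 0) + (if 2 * m' <ᵇ K then suc (φ (2 * m')) else 0)
      ≡⟨ cong₂ _+_ (if-cong (dec-false (K <? K) (n≮n K)))
                   (trans (if-cong (dec-true (2 * m' <? K) ≤-refl)) (label-pathEdge-even ≤-refl (parity-2* m'))) ⟩
    K ∸ 2 * m'                                                          ≡⟨ m+n∸n≡m 1 (2 * m') ⟩
    1                                                                   ∎
    where open ≡-Reasoning

  pathPart-null : ∀ j → pathPart (N + j) ≡ 0
  pathPart-null j = trans (pathPart≡ (N + j))
    (cong₂ _+_ (if-cong (dec-false (N + j <? K) (<⇒≯ (m≤m+n N j))))
               (if-cong (dec-false (K + j <? K) (m+n≮m K j))))

  α β γ : ℕ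
  α = K + (M * N + (n * (2 * m') + ∑[ j < M ] j * N))
  β = suc N + (M * N + ((2 * m' + n' * N) + ∑[ j < M ] j * N))
  γ = N * N + (∑[ i < N ] i + m * pred M * N)

  pathVertexSum : ∀ {t r p} → t < N → ∑[ j < M ] lowDigit t j ≡ r → pathPart t ≡ p →
                   pathPart t + joinPart t ≡ p + (M * N + (r + ∑[ j < M ] j * N))
  pathVertexSum {t} t<N row path = cong₂ _+_ path
    (trans (joinPart-row t<N) (cong (λ x → M * N + x) (cong₂ _+_ row (cong (_* N) (highDigit-row t)))))

  lowDigit-row-even : ∀ {t} → t < K → parity t ≡ 0ℙ → ∑[ j < M ] lowDigit t j ≡ n * (2 * m')
  lowDigit-row-even {t} t<K even = begin
    ∑[ j < M ] lowDigit t j                      ≡⟨ lowDigit-row t ⟩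
    n * t + (τ t + n' * π t)                     ≡⟨ cong₂ (λ a b → n * t + (a + n' * b)) (τ-< t<K)
                                                          (cong (byParity (K ∸ suc t) (N ∸ t)) even) ⟩
    n * t + ((2 * m' ∸ t) + n' * (2 * m' ∸ t))   ≡⟨ distribute n' t (2 * m' ∸ t) ⟩
    n * (t + (2 * m' ∸ t))                       ≡⟨ cong (n *_) (m+[n∸m]≡n (≤-pred t<K)) ⟩
    n * (2 * m')                                 ∎
    where
    open ≡-Reasoning
    distribute : ∀ n' t s → suc n' * t + (s + n' * s) ≡ suc n' * (t + s)
    distribute = solve-∀

  lowDigit-row-odd : ∀ {t} → t < K → parity t ≡ 1ℙ → ∑[ j < M ] lowDigit t j ≡ 2 * m' + n' * N
  lowDigit-row-odd {t} t<K odd = begin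
    ∑[ j < M ] lowDigit t j                      ≡⟨ lowDigit-row t ⟩
    n * t + (τ t + n' * π t)                     ≡⟨ cong₂ (λ a b → n * t + (a + n' * b)) (τ-< t<K)
                                                          (trans (cong (byParity (K ∸ suc t) (N ∸ t)) odd)
                                                                 (+-∸-assoc 2 (≤-pred t<K))) ⟩
    n * t + ((2 * m' ∸ t) + n' * (2 + (2 * m' ∸ t)))    ≡⟨ distribute n' t (2 * m' ∸ t) ⟩
    (t + (2 * m' ∸ t)) + n' * (2 + (t + (2 * m' ∸ t))) ≡⟨ cong (λ x → x + n' * (2 + x)) (m+[n∸m]≡n (≤-pred t<K)) ⟩
    2 * m' + n' * N                              ∎
    where
    open ≡-Reasoning
    distribute : ∀ n' t s → suc n' * t + (s + n' * (2 + s)) ≡ (t + s) + n' * (2 + (t + s))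
    distribute = solve-∀

  lowDigit-row-K : ∑[ j < M ] lowDigit K j ≡ n * K + (K + n' * 1)
  lowDigit-row-K = trans (lowDigit-row K)
    (cong₂ (λ a b → n * K + (a + n' * b)) τ-K
           (trans (cong (byParity (K ∸ suc K) (N ∸ K)) parity-K) (m+n∸n≡m 1 K)))

  pathVertexSum-even : ∀ {t} → t < N → parity t ≡ 0ℙ → pathPart t + joinPart t ≡ α
  pathVertexSum-even t<N even =
    pathVertexSum t<N (lowDigit-row-even (even<N⇒<K t<N even) even) (pathPart-even t<N even)

  pathVertexSum-odd : ∀ {t} → t < N → parity t ≡ 1ℙ → pathPart t + joinPart t ≡ β
  pathVertexSum-odd {t} t<N odd with m≤n⇒m<n∨m≡n (≤-pred t<N)
  ... | inj₁ t<K = pathVertexSum t<N (lowDigit-row-odd t<K odd) (pathPart-odd t<K odd)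
  ... | inj₂ refl = trans (pathVertexSum t<N lowDigit-row-K pathPart-K) (last m' n' (M * N) (∑[ j < M ] j * N))
    where
    last : ∀ m' n' A B → 1 + (A + ((suc n' * suc (2 * m') + (suc (2 * m') + n' * 1)) + B))
                        ≡ 3 + 2 * m' + (A + ((2 * m' + n' * (2 + 2 * m')) + B))
    last = solve-∀

  nullVertexSum : ∀ {j} → j < M → pathPart (N + j) + joinPart (N + j) ≡ γ
  nullVertexSum {j} j<M = cong₂ _+_ (pathPart-null j)
    (trans (joinPart-column j<M)
           (cong (N * N +_) (cong₂ _+_ (lowDigit-column j) (cong (_* N) (highDigit-column j<M)))))

  c : ℕ
  c = 2 * (2 * m * n + 2 * m' + 1)

  γ+m'+n*c≡α+m*c : γ + m' + n * c ≡ α + m * c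
  γ+m'+n*c≡α+m*c = begin
    γ + m' + n * c
      ≡⟨ cong₂ (λ T P → N * N + (T + m * P * N) + m' + n * c) (∑-range m') (+-suc n' (n' + 0)) ⟩
    N * N + (m * K + m * suc (2 * n') * N) + m' + n * c
      ≡⟨ identity m' n' ⟩
    K + (M * N + (n * (2 * m') + n * suc (2 * n') * N)) + m * c
      ≡⟨ cong (λ S → K + (M * N + (n * (2 * m') + S * N)) + m * c)
              (sym (trans (cong (λ L → ∑< L id) (*-suc 2 n')) (∑-range n'))) ⟩
    α + m * c
      ∎
    where
    open ≡-Reasoning
    identity : ∀ m' n' →
      (2 + 2 * m') * (2 + 2 * m') + (suc m' * suc (2 * m') + suc m' * suc (2 * n') * (2 + 2 * m')) + m'
        + suc n' * (2 * (2 * suc m' * suc n' + 2 * m' + 1))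
      ≡ suc (2 * m') + (2 * suc n' * (2 + 2 * m') + (suc n' * (2 * m') + suc n' * suc (2 * n') * (2 + 2 * m')))
        + suc m' * (2 * (2 * suc m' * suc n' + 2 * m' + 1))
    identity = solve-∀

  β≡α+2n : β ≡ α + 2 * n
  β≡α+2n = identity m' n' (∑[ j < M ] j * N)
    where
    identity : ∀ m' n' S → 3 + 2 * m' + (2 * suc n' * (2 + 2 * m') + ((2 * m' + n' * (2 + 2 * m')) + S))
                         ≡ suc (2 * m') + (2 * suc n' * (2 + 2 * m') + (suc n' * (2 * m') + S)) + 2 * suc n'
    identity = solve-∀

  2n+m'<c : 2 * n + m' < c
  2n+m'<c = subst (2 * n + m' <_) (sym (identity m' n')) (m<m+n (2 * n + m') z<s)
    where
    identity : ∀ m' n' → 2 * (2 * suc m' * suc n' + 2 * m' + 1)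
                       ≡ 2 * suc n' + m' + suc (4 * m' * n' + 7 * m' + 2 * n' + 3)
    identity = solve-∀

  α≢β : α ≢ β
  α≢β α≡β = m+1+n≢m α (sym (trans α≡β β≡α+2n))

  α≡γ⇒m'+n*c≡m*c : α ≡ γ → m' + n * c ≡ m * c
  α≡γ⇒m'+n*c≡m*c α≡γ = +-cancelˡ-≡ γ _ _ (begin
    γ + (m' + n * c)   ≡⟨ sym (+-assoc γ m' _) ⟩
    γ + m' + n * c     ≡⟨ γ+m'+n*c≡α+m*c ⟩
    α + m * c          ≡⟨ cong (_+ m * c) α≡γ ⟩
    γ + m * c          ∎)
    where open ≡-Reasoning

  β≡γ⇒2n+m'+n*c≡m*c : β ≡ γ → 2 * n + m' + n * c ≡ m * c
  β≡γ⇒2n+m'+n*c≡m*c β≡γ = +-cancelˡ-≡ α _ _ (begin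
    α + (2 * n + m' + n * c)   ≡⟨ sym (+-assoc α _ _) ⟩
    α + (2 * n + m') + n * c   ≡⟨ cong (_+ n * c) (sym (+-assoc α (2 * n) m')) ⟩
    α + 2 * n + m' + n * c     ≡⟨ cong (λ x → x + m' + n * c) (trans (sym β≡α+2n) β≡γ) ⟩
    γ + m' + n * c             ≡⟨ γ+m'+n*c≡α+m*c ⟩
    α + m * c                  ∎)
    where open ≡-Reasoning

  α≢γ : ¬ (m' ≡ 0 × n' ≡ 0) → α ≢ γ
  α≢γ nontrivial α≡γ = nontrivial (m'≡0 , trans (suc-injective n≡m) m'≡0)
    where
    m'<c = ≤-trans (s≤s (m≤n+m m' (2 * n))) 2n+m'<c
    m'≡0 = proj₁ (r+a*c≡b*c⇒r≡0×a≡b n m m'<c (α≡γ⇒m'+n*c≡m*c α≡γ))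
    n≡m = proj₂ (r+a*c≡b*c⇒r≡0×a≡b n m m'<c (α≡γ⇒m'+n*c≡m*c α≡γ))

  β≢γ : β ≢ γ
  β≢γ β≡γ = 1+n≢0 (proj₁ (r+a*c≡b*c⇒r≡0×a≡b n m 2n+m'<c (β≡γ⇒2n+m'+n*c≡m*c β≡γ)))

  pathVertexSum-byParity : ∀ {t} p → t < N → parity t ≡ p → pathPart t + joinPart t ≡ byParity α β p
  pathVertexSum-byParity 0ℙ = pathVertexSum-even
  pathVertexSum-byParity 1ℙ = pathVertexSum-odd

  colour : ℕ → ℕ
  colour t = if t <ᵇ N then byParity α β (parity t) else γ

  colour-path : ∀ {t} → t < N → colour t ≡ byParity α β (parity t)
  colour-path {t} t<N = if-cong (dec-true (t <? N) t<N)

  colour-null : ∀ {u} → N ≤ u → colour u ≡ γ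
  colour-null {u} N≤u = if-cong (dec-false (u <? N) (≤⇒≯ N≤u))

  labeling : Labeling G
  labeling = proj₁ φ-labeling

  vsum≡colour : ∀ x → vsum G labeling x ≡ colour (toℕ x)
  vsum≡colour x = trans (vsum-join labeling (proj₂ φ-labeling) x) (vertexSum (toℕ x) (toℕ<n x))
    where
    vertexSum : ∀ t → t < N + M → pathPart t + joinPart t ≡ colour t
    vertexSum t t<N+M with t <? N
    ... | yes t<N = trans (pathVertexSum-byParity (parity t) t<N refl) (sym (colour-path t<N))
    ... | no  t≮N = subst (λ t → pathPart t + joinPart t ≡ colour t) (m+[n∸m]≡n N≤t)
                      (trans (nullVertexSum (+-cancelˡ-< N _ _ (subst (_< N + M) (sym (m+[n∸m]≡n N≤t)) t<N+M)))
                             (sym (colour-null (m≤m+n N (t ∸ N)))))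
      where N≤t = ≮⇒≥ t≮N

  antimagic : ¬ (m' ≡ 0 × n' ≡ 0) → IsLocalAntimagic G labeling
  antimagic nontrivial = localAntimagic-join K M labeling colour vsum≡colour path≢ join≢
    where
    path≢ : ∀ t → suc t < N → colour t ≢ colour (suc t)
    path≢ t 1+t<N eq with parity t | trans (sym (colour-path (<-trans (n<1+n t) 1+t<N)))
                                        (trans eq (trans (colour-path 1+t<N) (cong (byParity α β) (parity-suc t))))
    ... | 0ℙ | α≡β = α≢β α≡β
    ... | 1ℙ | β≡α = α≢β (sym β≡α)
    join≢ : ∀ {t u} → t < N → N ≤ u → colour t ≢ colour u
    join≢ {t} t<N N≤u eq with parity t | trans (sym (colour-path t<N)) (trans eq (colour-null N≤u))
    ... | 0ℙ | α≡γ = α≢γ nontrivial α≡γ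
    ... | 1ℙ | β≡γ = β≢γ β≡γ

  colour∈ : ∀ t → colour t ∈ α ∷ β ∷ γ ∷ []
  colour∈ t with t <ᵇ N | parity t
  ... | true  | 0ℙ = here refl
  ... | true  | 1ℙ = there (here refl)
  ... | false | _  = there (there (here refl))

  χla≡3 : ¬ (m' ≡ 0 × n' ≡ 0) → LocalAntimagicChromatic≡ G 3
  χla≡3 nontrivial =
    (labeling , antimagic nontrivial , ≤-antisym numColors≤3 (3≤numColors (2 * m') _ labeling (antimagic nontrivial))) ,
    3≤numColors (2 * m') _
    where
    numColors≤3 : numColors G labeling ≤ 3
    numColors≤3 = numColors≤ G labeling (α ∷ β ∷ γ ∷ []) λ x →
      subst (_∈ α ∷ β ∷ γ ∷ []) (sym (vsum≡colour x)) (colour∈ (toℕ x))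

-- Here the general labeling has α = γ = 7. Swapping the labels 4 and 5 of the last two edges gives
-- the vertex sums 6, 10, 7, 7.
χla-P₂∨O₂ : LocalAntimagicChromatic≡ (join (P 2) (O 2)) 3
χla-P₂∨O₂ = (labeling , antimagic , refl) , 3≤numColors 0 1
  where
  G = join (P 2) (O 2)
  σ = transpose (# 3) (# 4)
  labeling : Labeling G
  labeling = Inverse.to σ , Bijection.bijective (↔⇒⤖ σ)
  antimagic : IsLocalAntimagic G labeling
  antimagic = toWitness {a? = all? λ e → ¬? (vsum G labeling (proj₁ (ends G e)) ≟ vsum G labeling (proj₂ (ends G e)))}
                        _

χla-P₂ₘ∨O₂ₙ : ∀ m' n' → ¬ (m' ≡ 0 × n' ≡ 0) →
  LocalAntimagicChromatic≡ (join (P (2 * suc m')) (O (2 * suc n'))) 3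
χla-P₂ₘ∨O₂ₙ m' n' nontrivial = subst (λ N → LocalAntimagicChromatic≡ (join (P N) (O (2 * suc n'))) 3)
  (sym (*-suc 2 m')) (P₂ₘ∨O₂ₙ.χla≡3 m' n' nontrivial)

mainTheorem3 : ∀ (m n : ℕ) → 1 ≤ m → 1 ≤ n →
    LocalAntimagicChromatic≡ (join (P (2 * m)) (O (2 * n))) 3
mainTheorem3 1               1               _ _ = χla-P₂∨O₂
mainTheorem3 1               (suc (suc n'))  _ _ = χla-P₂ₘ∨O₂ₙ 0 (suc n') λ { (_ , ()) }
mainTheorem3 (suc (suc m'))  (suc n')        _ _ = χla-P₂ₘ∨O₂ₙ (suc m') n' λ { (() , _) }
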